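{- Let $k\in\mathbb{N}$, $X=x_1\cdots x_{k^2}\in\{0,1\}^{k^2}$ and $\iota\in[k^2]$. Fix a bijection $\phi:[k^2]\to[k]\times[k]$ and write $\phi(\iota)=(I,J)$. Let $G_X$ be the graph with vertices $v_i,v'_i,v''_i,w_i,w'_i,w''_i$ for $i\in[k]$ and the following edges: $(v_i,w_j)$ for every $i,j\in[k]$ such that $x_{\phi^{ -1}(i,j)}=1$; $(v_i,v'_i)$ and $(v_i,v''_i)$ for every $i\in[k]$ with $i\neq I$; and $(w_j,w'_j)$ and $(w_j,w''_j)$ for every $j\in[k]$ with $j\neq J$. Then the minimum size of a vertex cover of $G_X$ is $2k-1$ if and only if $x_\iota=1$.
   Context: A vertex cover of a graph is a set of vertices containing at least one endpoint of every edge. $[k]=\{1,\dots,k\}$. -}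

module Defs where

open import Data.Nat using (ℕ; _*_; _≤_)
open import Data.Fin using (Fin)
open import Data.Bool using (Bool; true; false; _≟_)
open import Data.List using (List; []; _∷_; _++_; map; length; filter; allFin)
open import Data.List.Relation.Unary.All using (All)
open import Data.Product using (Σ; _×_; _,_; proj₁; proj₂)
open import Data.Sum using (_⊎_)
open import Relation.Binary.PropositionalEquality using (_≡_; _≢_)
open import Relation.Nullary using (¬_)
open import Data.Bool using (T)
open import Relation.Nullary.Decidable using (Dec)
open import Function.Bundles using (_↔_; Inverse)

data Vtx (k : ℕ) : Set where
  v v′ v″ w w′ w″ : Fin k → Vtx k

allVtx : (k : ℕ) → List (Vtx k)
allVtx k = map v (allFin k) ++ map v′ (allFin k) ++ map v″ (allFin k)
        ++ map w (allFin k) ++ map w′ (allFin k) ++ map w″ (allFin k)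

Graph : ℕ → Set₁
Graph k = Vtx k → Vtx k → Set

-- The graph G_X, for X ∈ {0,1}^{k²}, bijection φ : [k²] → [k]×[k], and
-- φ(ι) = (I , J).  Edges are listed in one orientation; vertex-cover
-- conditions only depend on the unordered pair.
data GX {k : ℕ} (X : Fin (k * k) → Bool) (φ : Fin (k * k) ↔ (Fin k × Fin k))
        (ι : Fin (k * k)) : Vtx k → Vtx k → Set where
  vw   : (i j : Fin k) → X (Inverse.from φ (i , j)) ≡ true
       → GX X φ ι (v i) (w j)
  vv′  : (i : Fin k) → i ≢ proj₁ (Inverse.to φ ι)
       → GX X φ ι (v i) (v′ i)
  vv″  : (i : Fin k) → i ≢ proj₁ (Inverse.to φ ι)
       → GX X φ ι (v i) (v″ i)
  ww′  : (j : Fin k) → j ≢ proj₂ (Inverse.to φ ι)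
       → GX X φ ι (w j) (w′ j)
  ww″  : (j : Fin k) → j ≢ proj₂ (Inverse.to φ ι)
       → GX X φ ι (w j) (w″ j)

VSet : ℕ → Set
VSet k = Vtx k → Bool

size : {k : ℕ} → VSet k → ℕ
size {k} S = length (filter (λ x → S x ≟ true) (allVtx k))

IsVertexCover : {k : ℕ} → Graph k → VSet k → Set
IsVertexCover E S = ∀ a b → E a b → (S a ≡ true) ⊎ (S b ≡ true)

MinVCSize : {k : ℕ} → Graph k → ℕ → Set
MinVCSize {k} E m =
  (Σ (VSet k) λ S → IsVertexCover E S × size S ≡ m)
  × (∀ S → IsVertexCover E S → m ≤ size S)

module Submission where

-- The set {v_i : i ≠ I} ∪ {w_j : j ∈ [k]}
-- is always a cover of size 2k - 1.  If x_ι = 0 the edge v_I w_J is absent,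
-- so {v_i : i ≠ I} ∪ {w_j : j ≠ J} is a cover of size 2k - 2 and the minimum
-- is smaller than 2k - 1.  If x_ι = 1, every cover S meets each pair
-- {v_i , v'_i} with i ≠ I and each pair {w_j , w'_j} with j ≠ J, and it
-- meets {v_I , w_J}; hence it meets at least 2k - 1 of the 2k pairs, and
-- these pairs are disjoint, so |S| ≥ 2k - 1.

open import Defs
open import Data.Nat using (ℕ; _*_; _+_; _∸_)
open import Data.Fin using (Fin)
open import Data.Bool using (Bool; true)
open import Data.Product using (_×_)
open import Relation.Binary.PropositionalEquality using (_≡_)
open import Function.Bundles using (_↔_; _⇔_)

open import Data.Nat using (zero; suc; _≤_; z≤n; s≤s)
open import Data.Nat.Properties
  using (≤-refl; ≤-trans; ≤-reflexive; +-mono-≤; +-monoʳ-≤; +-assoc; +-comm; +-identityʳ;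
         m≤m+n; m≤n+m; +-cancelˡ-≤; n≮n; +-commutativeSemigroup; module ≤-Reasoning)
open import Algebra.Properties.CommutativeSemigroup +-commutativeSemigroup using (interchange)
open import Data.Fin using (zero; suc; _≟_)
open import Data.Bool using (false; _∨_) renaming (_≟_ to _≟ᵇ_)
open import Data.List using (List; _++_; map; length; filter; tabulate; allFin)
open import Data.List.Properties using (filter-++; length-++; map-tabulate)
open import Data.Product using (_,_; proj₁; proj₂)
open import Data.Sum using (_⊎_; inj₁; inj₂)
open import Data.Empty using (⊥-elim)
open import Relation.Nullary using (yes; no)
open import Relation.Binary.PropositionalEquality
  using (refl; sym; trans; cong; cong₂; _≢_; module ≡-Reasoning)
open import Function.Bundles using (Inverse; mk⇔)

bit : Bool → ℕ
bit true  = 1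
bit false = 0

count : ∀ {n} → (Fin n → Bool) → ℕ
count {zero}  f = 0
count {suc n} f = bit (f zero) + count (λ i → f (suc i))

_⊆_ : ∀ {n} → (Fin n → Bool) → (Fin n → Bool) → Set
f ⊆ g = ∀ i → f i ≡ true → g i ≡ true

count-false : ∀ n → count {n} (λ _ → false) ≡ 0
count-false zero    = refl
count-false (suc n) = count-false n

count-true : ∀ n → count {n} (λ _ → true) ≡ n
count-true zero    = refl
count-true (suc n) = cong suc (count-true n)

bit-mono : ∀ {a b} → (a ≡ true → b ≡ true) → bit a ≤ bit b
bit-mono {false}         _ = z≤n
bit-mono {true} {true}   _ = ≤-refl
bit-mono {true} {false}  h with h refl
... | ()

count-mono : ∀ {n} {f g : Fin n → Bool} → f ⊆ g → count f ≤ count g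
count-mono {zero}  _ = z≤n
count-mono {suc n} h = +-mono-≤ (bit-mono (h zero)) (count-mono (λ i → h (suc i)))

bit-∨ : ∀ a b → bit (a ∨ b) ≤ bit a + bit b
bit-∨ true  _ = s≤s z≤n
bit-∨ false _ = ≤-refl

count-∨ : ∀ {n} (f g : Fin n → Bool) → count (λ i → f i ∨ g i) ≤ count f + count g
count-∨ {zero}  _ _ = z≤n
count-∨ {suc n} f g =
  ≤-trans (+-mono-≤ (bit-∨ (f zero) (g zero)) (count-∨ (λ i → f (suc i)) (λ i → g (suc i))))
          (≤-reflexive (interchange (bit (f zero)) (bit (g zero)) _ _))

allBut : ∀ {n} → Fin n → Fin n → Bool
allBut zero    zero    = false
allBut zero    (suc i) = true
allBut (suc I) zero    = true
allBut (suc I) (suc i) = allBut I i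

allBut-self : ∀ {n} (I : Fin n) → allBut I I ≡ false
allBut-self zero    = refl
allBut-self (suc I) = allBut-self I

allBut-other : ∀ {n} {I i : Fin n} → i ≢ I → allBut I i ≡ true
allBut-other {I = zero}  {zero}  i≢I = ⊥-elim (i≢I refl)
allBut-other {I = zero}  {suc i} _   = refl
allBut-other {I = suc I} {zero}  _   = refl
allBut-other {I = suc I} {suc i} i≢I = allBut-other (λ i≡I → i≢I (cong suc i≡I))

count-allBut : ∀ {n} (I : Fin (suc n)) → count (allBut I) ≡ n
count-allBut {n}     zero    = count-true n
count-allBut {suc n} (suc I) = cong suc (count-allBut I)

allBut-⊆ : ∀ {n} {I : Fin n} {f : Fin n → Bool} →
           (∀ i → i ≢ I → f i ≡ true) → allBut I ⊆ f
allBut-⊆ {I = I} h i allBut-i with i ≟ I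
... | no  i≢I  = h i i≢I
... | yes refl with trans (sym allBut-i) (allBut-self I)
... | ()

fill-point : ∀ {n} {I : Fin n} {f : Fin n → Bool} →
             (∀ i → i ≢ I → f i ≡ true) → f I ≡ true → ∀ i → f i ≡ true
fill-point {I = I} h fI i with i ≟ I
... | yes refl = fI
... | no  i≢I  = h i i≢I

count-full : ∀ {n} {f : Fin n → Bool} → (∀ i → f i ≡ true) → n ≤ count f
count-full {n} h = ≤-trans (≤-reflexive (sym (count-true n))) (count-mono (λ i _ → h i))

count-almost-full : ∀ {n} (I : Fin (suc n)) {f : Fin (suc n) → Bool} →
                    (∀ i → i ≢ I → f i ≡ true) → n ≤ count f
count-almost-full I h = ≤-trans (≤-reflexive (sym (count-allBut I))) (count-mono (allBut-⊆ h))

two-families-bound : ∀ {n} (I J : Fin n) {f g : Fin n → Bool} →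
  (∀ i → i ≢ I → f i ≡ true) → (∀ j → j ≢ J → g j ≡ true) →
  (f I ≡ true) ⊎ (g J ≡ true) → 2 * n ∸ 1 ≤ count f + count g
two-families-bound {suc n} I J {f} {g} hf hg (inj₁ fI) = begin
  n + (suc n + 0)    ≡⟨ cong (n +_) (+-identityʳ (suc n)) ⟩
  n + suc n          ≡⟨ +-comm n (suc n) ⟩
  suc n + n          ≤⟨ +-mono-≤ (count-full (fill-point hf fI)) (count-almost-full J hg) ⟩
  count f + count g  ∎
  where open ≤-Reasoning
two-families-bound {suc n} I J {f} {g} hf hg (inj₂ gJ) = begin
  n + (suc n + 0)    ≡⟨ cong (n +_) (+-identityʳ (suc n)) ⟩
  n + suc n          ≤⟨ +-mono-≤ (count-almost-full I hf) (count-full (fill-point hg gJ)) ⟩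
  count f + count g  ∎
  where open ≤-Reasoning

module _ {k : ℕ} (S : VSet k) where

  countIn : List (Vtx k) → ℕ
  countIn xs = length (filter (λ x → S x ≟ᵇ true) xs)

  countIn-++ : ∀ xs ys → countIn (xs ++ ys) ≡ countIn xs + countIn ys
  countIn-++ xs ys = trans (cong length (filter-++ (λ x → S x ≟ᵇ true) xs ys))
                           (length-++ (filter (λ x → S x ≟ᵇ true) xs))

  countIn-tabulate : ∀ {n} (h : Fin n → Vtx k) → countIn (tabulate h) ≡ count (λ i → S (h i))
  countIn-tabulate {zero}  h = refl
  countIn-tabulate {suc n} h with S (h zero)
  ... | true  = cong suc (countIn-tabulate (λ i → h (suc i)))
  ... | false = countIn-tabulate (λ i → h (suc i))

  countIn-kind : (c : Fin k → Vtx k) → countIn (map c (allFin k)) ≡ count (λ i → S (c i))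
  countIn-kind c = trans (cong countIn (map-tabulate (λ i → i) c)) (countIn-tabulate c)

  size-by-kind : size S ≡ count (λ i → S (v i)) + (count (λ i → S (v′ i)) + (count (λ i → S (v″ i))
                  + (count (λ i → S (w i)) + (count (λ i → S (w′ i)) + count (λ i → S (w″ i))))))
  size-by-kind =
    trans (countIn-++ (map v (allFin k)) _) (cong₂ _+_ (countIn-kind v)
    (trans (countIn-++ (map v′ (allFin k)) _) (cong₂ _+_ (countIn-kind v′)
    (trans (countIn-++ (map v″ (allFin k)) _) (cong₂ _+_ (countIn-kind v″)
    (trans (countIn-++ (map w (allFin k)) _) (cong₂ _+_ (countIn-kind w)
    (trans (countIn-++ (map w′ (allFin k)) _) (cong₂ _+_ (countIn-kind w′)
    (countIn-kind w″))))))))))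

  -- The pairs {v_i , v'_i} and {w_j , w'_j} are disjoint, so the number of
  -- such pairs met by S is at most |S|.
  pairs-met≤size : count (λ i → S (v i) ∨ S (v′ i)) + count (λ j → S (w j) ∨ S (w′ j)) ≤ size S
  pairs-met≤size = begin
    count (λ i → S (v i) ∨ S (v′ i)) + count (λ j → S (w j) ∨ S (w′ j))
      ≤⟨ +-mono-≤ (count-∨ (λ i → S (v i)) (λ i → S (v′ i))) (count-∨ (λ j → S (w j)) (λ j → S (w′ j))) ⟩
    (#v + #v′) + (#w + #w′)
      ≡⟨ +-assoc #v #v′ (#w + #w′) ⟩
    #v + (#v′ + (#w + #w′))
      ≤⟨ +-monoʳ-≤ #v (+-monoʳ-≤ #v′ (≤-trans (+-monoʳ-≤ #w (m≤m+n #w′ #w″)) (m≤n+m _ #v″))) ⟩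
    #v + (#v′ + (#v″ + (#w + (#w′ + #w″))))
      ≡⟨ sym size-by-kind ⟩
    size S ∎
    where
    open ≤-Reasoning
    #v #v′ #v″ #w #w′ #w″ : ℕ
    #v  = count (λ i → S (v i))
    #v′ = count (λ i → S (v′ i))
    #v″ = count (λ i → S (v″ i))
    #w  = count (λ i → S (w i))
    #w′ = count (λ i → S (w′ i))
    #w″ = count (λ i → S (w″ i))

vwSet : ∀ {k} → (Fin k → Bool) → (Fin k → Bool) → VSet k
vwSet a b (v i) = a i
vwSet a b (w j) = b j
vwSet a b _     = false

size-vwSet : ∀ {k} (a b : Fin k → Bool) → size (vwSet a b) ≡ count a + count b
size-vwSet {k} a b = begin
  size (vwSet a b)
    ≡⟨ size-by-kind (vwSet a b) ⟩
  count a + (none + (none + (count b + (none + none))))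
    ≡⟨ cong (λ z → count a + (z + (z + (count b + (z + z))))) (count-false k) ⟩
  count a + (count b + 0)
    ≡⟨ cong (count a +_) (+-identityʳ (count b)) ⟩
  count a + count b ∎
  where
  open ≡-Reasoning
  none : ℕ
  none = count {k} (λ _ → false)

∨-intro : ∀ {a b : Bool} → (a ≡ true) ⊎ (b ≡ true) → a ∨ b ≡ true
∨-intro {true}  _        = refl
∨-intro {false} (inj₂ b) = b

∨-introˡ : ∀ {a b : Bool} → a ≡ true → a ∨ b ≡ true
∨-introˡ a = ∨-intro (inj₁ a)

module _ {k : ℕ} (X : Fin (k * k) → Bool) (φ : Fin (k * k) ↔ (Fin k × Fin k)) (ι : Fin (k * k)) where

  private
    I J : Fin k
    I = proj₁ (Inverse.to φ ι)
    J = proj₂ (Inverse.to φ ι)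

  -- The edge v_I w_J is present exactly when x_ι = 1.
  key-edge : X (Inverse.from φ (I , J)) ≡ X ι
  key-edge = cong X (Inverse.inverseʳ φ refl)

  cover-allW : IsVertexCover (GX X φ ι) (vwSet (allBut I) (λ _ → true))
  cover-allW _ _ (vw i j _)   = inj₂ refl
  cover-allW _ _ (vv′ i i≢I) = inj₁ (allBut-other i≢I)
  cover-allW _ _ (vv″ i i≢I) = inj₁ (allBut-other i≢I)
  cover-allW _ _ (ww′ j _)    = inj₁ refl
  cover-allW _ _ (ww″ j _)    = inj₁ refl

  cover-small : X ι ≡ false → IsVertexCover (GX X φ ι) (vwSet (allBut I) (allBut J))
  cover-small xι _ _ (vw i j x) with i ≟ I | j ≟ J
  ... | no i≢I   | _        = inj₁ (allBut-other i≢I)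
  ... | yes _    | no j≢J   = inj₂ (allBut-other j≢J)
  ... | yes refl | yes refl with trans (sym x) (trans key-edge xι)
  ... | ()
  cover-small _ _ _ (vv′ i i≢I) = inj₁ (allBut-other i≢I)
  cover-small _ _ _ (vv″ i i≢I) = inj₁ (allBut-other i≢I)
  cover-small _ _ _ (ww′ j j≢J) = inj₁ (allBut-other j≢J)
  cover-small _ _ _ (ww″ j j≢J) = inj₁ (allBut-other j≢J)

  -- With the edge v_I w_J, every cover has at least 2k - 1 vertices: it meets
  -- the pairs {v_i , v'_i} (i ≠ I), {w_j , w'_j} (j ≠ J), and {v_I , w_J}.
  cover-lower-bound : X ι ≡ true → ∀ S → IsVertexCover (GX X φ ι) S → 2 * k ∸ 1 ≤ size S
  cover-lower-bound xι S cover = ≤-trans (two-families-bound I J v-pairs w-pairs v-or-w) (pairs-met≤size S)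
    where
    v-pairs : ∀ i → i ≢ I → S (v i) ∨ S (v′ i) ≡ true
    v-pairs i i≢I = ∨-intro (cover _ _ (vv′ i i≢I))
    w-pairs : ∀ j → j ≢ J → S (w j) ∨ S (w′ j) ≡ true
    w-pairs j j≢J = ∨-intro (cover _ _ (ww′ j j≢J))
    v-or-w : (S (v I) ∨ S (v′ I) ≡ true) ⊎ (S (w J) ∨ S (w′ J) ≡ true)
    v-or-w with cover _ _ (vw I J (trans key-edge xι))
    ... | inj₁ vI = inj₁ (∨-introˡ vI)
    ... | inj₂ wJ = inj₂ (∨-introˡ wJ)

lemma2 : (k : ℕ) (X : Fin (k * k) → Bool) (ι : Fin (k * k))
         (φ : Fin (k * k) ↔ (Fin k × Fin k))
         → MinVCSize (GX X φ ι) (2 * k ∸ 1) ⇔ (X ι ≡ true)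
lemma2 zero    X () φ
lemma2 (suc m) X ι  φ = mk⇔ only-if if
  where
  I J : Fin (suc m)
  I = proj₁ (Inverse.to φ ι)
  J = proj₂ (Inverse.to φ ι)

  -- 2k - 1 = m + (m + 1) and 2k - 2 = m + m for k = m + 1.
  size-allW : size (vwSet (allBut I) (λ _ → true)) ≡ 2 * suc m ∸ 1
  size-allW = trans (size-vwSet (allBut I) _)
                    (cong₂ _+_ (count-allBut I) (trans (count-true (suc m)) (sym (+-identityʳ (suc m)))))

  size-small : size (vwSet (allBut I) (allBut J)) ≡ m + m
  size-small = trans (size-vwSet (allBut I) (allBut J)) (cong₂ _+_ (count-allBut I) (count-allBut J))

  if : X ι ≡ true → MinVCSize (GX X φ ι) (2 * suc m ∸ 1)
  if xι = (_ , cover-allW X φ ι , size-allW) , cover-lower-bound X φ ι xι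

  only-if : MinVCSize (GX X φ ι) (2 * suc m ∸ 1) → X ι ≡ true
  only-if (_ , minimal) with X ι in xι
  ... | true  = refl
  ... | false = ⊥-elim (n≮n m (+-cancelˡ-≤ m (suc m) m too-small))
    where
    open ≤-Reasoning
    too-small : m + suc m ≤ m + m
    too-small = begin
      m + suc m                            ≡⟨ cong (m +_) (sym (+-identityʳ (suc m))) ⟩
      2 * suc m ∸ 1                        ≤⟨ minimal _ (cover-small X φ ι xι) ⟩
      size (vwSet (allBut I) (allBut J))   ≡⟨ size-small ⟩
      m + m                                ∎
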